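{- Let $G$ be a connected uniquely distinguishing colorable graph having a pendant vertex (vertex of degree one) that is fixed by every automorphism of $G$. Then $D(G)=1$ and $\chi_D(G)=2$.
   Context: $D(G)$, the distinguishing number, is the least $\ell$ such that $V(G)$ has a partition into $\ell$ classes (not necessarily independent) with the only automorphism mapping every class onto itself being the identity. A distinguishing $k$-coloring is such a partition into exactly $k$ non-empty independent sets; $\chi_D(G)$ is the least such $k$. $G$ is uniquely distinguishing colorable if there is exactly one partition of $V(G)$ into $\chi_D(G)$ classes forming a distinguishing coloring. -}

module Defs where

open import Data.Nat using (ℕ; _<_)
open import Data.Fin using (Fin)
open import Data.Bool using (Bool; true; false)
open import Data.Product using (Σ; ∃; ∃-syntax; _×_; _,_)
open import Relation.Nullary using (¬_)
open import Relation.Binary.PropositionalEquality using (_≡_; _≢_)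
open import Relation.Binary.Construct.Closure.ReflexiveTransitive using (Star)
open import Function.Bundles using (_⇔_)

record Graph (n : ℕ) : Set where
  field
    adj   : Fin n → Fin n → Bool
    sym   : ∀ u v → adj u v ≡ adj v u
    irrefl : ∀ v → adj v v ≡ false
open Graph public

Adj : ∀ {n} → Graph n → Fin n → Fin n → Set
Adj G u v = adj G u v ≡ true

Connected : ∀ {n} → Graph n → Set
Connected {n} G = ∀ (u v : Fin n) → Star (Adj G) u v

record Aut {n : ℕ} (G : Graph n) : Set where
  field
    σ      : Fin n → Fin n
    σ⁻¹    : Fin n → Fin n
    inv-l  : ∀ v → σ⁻¹ (σ v) ≡ v
    inv-r  : ∀ v → σ (σ⁻¹ v) ≡ v
    pres   : ∀ u v → adj G (σ u) (σ v) ≡ adj G u v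
open Aut public

-- A partition of V(G) into (at most) ℓ labelled classes is a map c : Fin n → Fin ℓ.
Distinguishing : ∀ {n ℓ} → Graph n → (Fin n → Fin ℓ) → Set
Distinguishing G c = ∀ (φ : Aut G) → (∀ v → c (σ φ v) ≡ c v) → ∀ v → σ φ v ≡ v

IsDistNumber : ∀ {n} → Graph n → ℕ → Set
IsDistNumber {n} G ℓ =
  (Σ (Fin n → Fin ℓ) λ c → Distinguishing G c) ×
  (∀ m → m < ℓ → ¬ (Σ (Fin n → Fin m) λ c → Distinguishing G c))

Proper : ∀ {n k} → Graph n → (Fin n → Fin k) → Set
Proper G c = ∀ u v → Adj G u v → c u ≢ c v

Onto : ∀ {n k} → (Fin n → Fin k) → Set
Onto {n} {k} c = ∀ (i : Fin k) → ∃[ v ] c v ≡ i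

IsDistColoring : ∀ {n k} → Graph n → (Fin n → Fin k) → Set
IsDistColoring G c = Proper G c × Onto c × Distinguishing G c

IsDistChromatic : ∀ {n} → Graph n → ℕ → Set
IsDistChromatic {n} G k =
  (Σ (Fin n → Fin k) λ c → IsDistColoring G c) ×
  (∀ m → m < k → ¬ (Σ (Fin n → Fin m) λ c → IsDistColoring G c))

SamePartition : ∀ {n k l} → (Fin n → Fin k) → (Fin n → Fin l) → Set
SamePartition {n} c c' = ∀ (u v : Fin n) → (c u ≡ c v) ⇔ (c' u ≡ c' v)

UniquelyDistColorable : ∀ {n} → Graph n → Set
UniquelyDistColorable {n} G =
  Σ ℕ λ k → IsDistChromatic G k ×
    (Σ (Fin n → Fin k) λ c → IsDistColoring G c ×
      (∀ (c' : Fin n → Fin k) → IsDistColoring G c' → SamePartition c c'))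

Pendant : ∀ {n} → Graph n → Fin n → Set
Pendant {n} G v = Σ (Fin n) λ w → Adj G v w × (∀ x → Adj G v x → x ≡ w)

FixedByAll : ∀ {n} → Graph n → Fin n → Set
FixedByAll G v = ∀ (φ : Aut G) → σ φ v ≡ v

-- If χ_D(G) = k ≥ 3, recolour the pendant vertex v with a colour avoiding both
-- its own colour and that of its unique neighbour w.  This is again a proper
-- distinguishing colouring, since v is fixed by every automorphism.  Either the
-- old colour of v survives, on some z ≠ v, and the new colouring separates z from
-- v — a second partition, contradicting uniqueness — or it disappears and the
-- colouring uses k − 1 colours, contradicting minimality.  Hence χ_D(G) = 2, and
-- an automorphism fixing v preserves a proper 2-colouring along every walk from v,
-- so it is the identity: G is asymmetric and D(G) = 1.
module Submission where

open import Defs hiding (sym)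
open import Data.Nat using (ℕ; zero; suc; _<_; _≤_; z≤n; s≤s)
open import Data.Nat.Properties using (n<1+n)
open import Data.Fin using (Fin; zero; suc; punchOut; punchIn; _≟_)
open import Data.Fin.Properties using (any?; punchOut-cong; punchOut-injective; punchOut-punchIn; punchInᵢ≢i)
open import Data.Vec.Functional using (updateAt)
open import Data.Vec.Functional.Properties using (updateAt-updates; updateAt-minimal)
open import Data.Product using (Σ; ∃-syntax; _×_; _,_)
open import Data.Sum using (_⊎_; inj₁; inj₂)
open import Data.Empty using (⊥-elim)
open import Function using (id; const; _∘_)
open import Function.Bundles using (Equivalence)
open import Relation.Nullary using (¬_; Dec; yes; no)
open import Relation.Binary.PropositionalEquality
  using (_≡_; _≢_; refl; sym; trans; cong; ≢-sym; module ≡-Reasoning)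
open import Relation.Binary.Construct.Closure.ReflexiveTransitive using (fold)

private
  variable
    n k : ℕ

Adj-irrefl : (G : Graph n) {x : Fin n} → ¬ Adj G x x
Adj-irrefl G {x} x~x with trans (sym x~x) (irrefl G x)
... | ()

Adj-sym : (G : Graph n) {x y : Fin n} → Adj G x y → Adj G y x
Adj-sym G {x} {y} x~y = trans (Graph.sym G y x) x~y

σ-injective : {G : Graph n} (φ : Aut G) {x y : Fin n} → σ φ x ≡ σ φ y → x ≡ y
σ-injective φ {x} {y} eq = trans (sym (inv-l φ x)) (trans (cong (σ⁻¹ φ) eq) (inv-l φ y))

σ-Adj : {G : Graph n} (φ : Aut G) {x y : Fin n} → Adj G x y → Adj G (σ φ x) (σ φ y)
σ-Adj φ {x} {y} x~y = trans (pres φ x y) x~y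

Fin2-≢-unique : {x y z : Fin 2} → x ≢ z → y ≢ z → x ≡ y
Fin2-≢-unique {zero}     {zero}     _   _   = refl
Fin2-≢-unique {suc zero} {suc zero} _   _   = refl
Fin2-≢-unique {zero}     {suc zero} {zero}     x≢z _   = ⊥-elim (x≢z refl)
Fin2-≢-unique {zero}     {suc zero} {suc zero} _   y≢z = ⊥-elim (y≢z refl)
Fin2-≢-unique {suc zero} {zero}     {zero}     _   y≢z = ⊥-elim (y≢z refl)
Fin2-≢-unique {suc zero} {zero}     {suc zero} x≢z _   = ⊥-elim (x≢z refl)

Fin-avoid₂ : (a b : Fin (suc (suc (suc k)))) → ∃[ j ] j ≢ a × j ≢ b
Fin-avoid₂ zero           zero           = suc zero , (λ ()) , (λ ())
Fin-avoid₂ zero           (suc zero)     = suc (suc zero) , (λ ()) , (λ ())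
Fin-avoid₂ zero           (suc (suc _))  = suc zero , (λ ()) , (λ ())
Fin-avoid₂ (suc zero)     zero           = suc (suc zero) , (λ ()) , (λ ())
Fin-avoid₂ (suc zero)     (suc _)        = zero , (λ ()) , (λ ())
Fin-avoid₂ (suc (suc _))  zero           = suc zero , (λ ()) , (λ ())
Fin-avoid₂ (suc (suc _))  (suc _)        = zero , (λ ()) , (λ ())

Fin1-unique : (x y : Fin 1) → x ≡ y
Fin1-unique zero zero = refl

proper-colouring-needs-two : {k : ℕ} (G : Graph n) {u w : Fin n} → Adj G u w →
  (c : Fin n → Fin k) → Proper G c → 2 ≤ k
proper-colouring-needs-two {k = zero}        G {u} u~w c pr with c u
... | ()
proper-colouring-needs-two {k = suc zero}    G {u} {w} u~w c pr = ⊥-elim (pr u w u~w (Fin1-unique (c u) (c w)))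
proper-colouring-needs-two {k = suc (suc _)} G u~w c pr = s≤s (s≤s z≤n)

Refines : {l : ℕ} → (Fin n → Fin k) → (Fin n → Fin l) → Set
Refines d c = ∀ x y → d x ≡ d y → c x ≡ c y

refines-proper : {l : ℕ} (G : Graph n) {d : Fin n → Fin k} {c : Fin n → Fin l} →
  Refines d c → Proper G c → Proper G d
refines-proper G d⊑c pr x y x~y = pr x y x~y ∘ d⊑c x y

refines-distinguishing : {l : ℕ} (G : Graph n) {d : Fin n → Fin k} {c : Fin n → Fin l} →
  Refines d c → Distinguishing G c → Distinguishing G d
refines-distinguishing G d⊑c dis φ d∘σ≡d = dis φ (λ u → d⊑c (σ φ u) u (d∘σ≡d u))

proper-2-colouring-invariant : (G : Graph n) → Connected G → {v : Fin n} → FixedByAll G v →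
  (c : Fin n → Fin 2) → Proper G c → (φ : Aut G) → ∀ u → c (σ φ u) ≡ c u
proper-2-colouring-invariant G conn {v} fix c pr φ u =
  fold (λ x y → Invariant x → Invariant y) (λ x~y f → f ∘ step x~y) id (conn v u) (cong c (fix φ))
  where
  Invariant : Fin _ → Set
  Invariant x = c (σ φ x) ≡ c x

  step : ∀ {x y} → Adj G x y → Invariant x → Invariant y
  step {x} {y} x~y inv-x = Fin2-≢-unique
    (λ eq → pr (σ φ x) (σ φ y) (σ-Adj φ x~y) (trans inv-x (sym eq)))
    (λ eq → pr x y x~y (sym eq))

asymmetric⇒IsDistNumber-1 : (G : Graph n) → Fin n → (∀ (φ : Aut G) u → σ φ u ≡ u) → IsDistNumber G 1
asymmetric⇒IsDistNumber-1 G v asymmetric = (const zero , λ φ _ → asymmetric φ) , no-fewer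
  where
  no-fewer : ∀ m → m < 1 → ¬ Σ (Fin _ → Fin m) (Distinguishing G)
  no-fewer zero    _         (c , _) with c v
  ... | ()
  no-fewer (suc _) (s≤s ()) _

recolour : (Fin n → Fin k) → Fin n → Fin k → Fin n → Fin k
recolour c v j = updateAt c v (const j)

module _ {c : Fin n → Fin k} {v : Fin n} {j : Fin k} where

  recolour-at : recolour c v j v ≡ j
  recolour-at = updateAt-updates v c

  recolour-elsewhere : ∀ {u} → u ≢ v → recolour c v j u ≡ c u
  recolour-elsewhere {u} = updateAt-minimal u v c

  recolour-pendant-differs : (G : Graph n) {w y : Fin n} → (∀ x → Adj G v x → x ≡ w) →
    j ≢ c w → Adj G v y → recolour c v j v ≢ recolour c v j y
  recolour-pendant-differs G {w} {y} pend j≢cw v~y eq = j≢cw (begin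
    j                 ≡⟨ sym recolour-at ⟩
    recolour c v j v  ≡⟨ eq ⟩
    recolour c v j y  ≡⟨ recolour-elsewhere y≢v ⟩
    c y               ≡⟨ cong c (pend y v~y) ⟩
    c w               ∎)
    where
    open ≡-Reasoning
    y≢v : y ≢ v
    y≢v refl = Adj-irrefl G v~y

  recolour-proper : (G : Graph n) {w : Fin n} → (∀ x → Adj G v x → x ≡ w) →
    Proper G c → j ≢ c w → Proper G (recolour c v j)
  recolour-proper G pend pr j≢cw x y x~y with x ≟ v | y ≟ v
  ... | yes refl | _        = recolour-pendant-differs G pend j≢cw x~y
  ... | no _     | yes refl = ≢-sym (recolour-pendant-differs G pend j≢cw (Adj-sym G x~y))
  ... | no x≢v   | no y≢v   = λ eq → pr x y x~y
    (trans (sym (recolour-elsewhere x≢v)) (trans eq (recolour-elsewhere y≢v)))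

  recolour-distinguishing : (G : Graph n) → FixedByAll G v → Distinguishing G c →
    Distinguishing G (recolour c v j)
  recolour-distinguishing G fix dis φ recoloured-invariant = dis φ invariant
    where
    invariant : ∀ u → c (σ φ u) ≡ c u
    invariant u with u ≟ v
    ... | yes refl = cong c (fix φ)
    ... | no u≢v   = begin
      c (σ φ u)                ≡⟨ sym (recolour-elsewhere σu≢v) ⟩
      recolour c v j (σ φ u)   ≡⟨ recoloured-invariant u ⟩
      recolour c v j u         ≡⟨ recolour-elsewhere u≢v ⟩
      c u                      ∎
      where
      open ≡-Reasoning
      σu≢v : σ φ u ≢ v
      σu≢v eq = u≢v (σ-injective φ (trans eq (sym (fix φ))))

  recolour-hits : Onto c → ∀ i → i ≢ c v → ∃[ y ] recolour c v j y ≡ i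
  recolour-hits onto i i≢cv with onto i
  ... | y , cy≡i = y , trans (recolour-elsewhere y≢v) cy≡i
    where
    y≢v : y ≢ v
    y≢v refl = i≢cv (sym cy≡i)

omit-colour : (c : Fin n → Fin (suc k)) {a : Fin (suc k)} → (∀ u → a ≢ c u) → Fin n → Fin k
omit-colour c a∉c u = punchOut (a∉c u)

module _ {c : Fin n → Fin (suc k)} {a : Fin (suc k)} (a∉c : ∀ u → a ≢ c u) where

  omit-colour-refines : Refines (omit-colour c a∉c) c
  omit-colour-refines x y = punchOut-injective (a∉c x) (a∉c y)

  omit-colour-onto : (∀ i → i ≢ a → ∃[ y ] c y ≡ i) → Onto (omit-colour c a∉c)
  omit-colour-onto hits i with hits (punchIn a i) (punchInᵢ≢i a i)
  ... | y , cy≡i = y , trans (punchOut-cong a cy≡i) (punchOut-punchIn a)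

recolour-pendant : (G : Graph n) {v w : Fin n} → (∀ x → Adj G v x → x ≡ w) → FixedByAll G v →
  {c : Fin n → Fin (suc k)} → IsDistColoring G c → {j : Fin (suc k)} → j ≢ c v → j ≢ c w →
  Σ (Fin n → Fin k) (IsDistColoring G) ⊎
  Σ (Fin n → Fin (suc k)) (λ c′ → IsDistColoring G c′ × ¬ SamePartition c c′)
recolour-pendant G {v} pend fix {c} (pr , onto , dis) {j} j≢cv j≢cw =
  split (any? (λ z → c′ z ≟ c v))
  where
  open ≡-Reasoning
  c′ : Fin _ → Fin _
  c′ = recolour c v j

  pr′ : Proper G c′
  pr′ = recolour-proper G pend pr j≢cw

  dis′ : Distinguishing G c′
  dis′ = recolour-distinguishing G fix dis

  split : Dec (∃[ z ] c′ z ≡ c v) →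
    Σ (Fin _ → Fin _) (IsDistColoring G) ⊎ Σ (Fin _ → Fin _) (λ c″ → IsDistColoring G c″ × ¬ SamePartition c c″)
  split (yes (z , c′z≡cv)) = inj₂ (c′ , (pr′ , onto′ , dis′) , separates)
    where
    z≢v : z ≢ v
    z≢v refl = j≢cv (trans (sym (recolour-at {c = c} {v})) c′z≡cv)

    onto′ : Onto c′
    onto′ i with i ≟ c v
    ... | yes refl = z , c′z≡cv
    ... | no i≢cv  = recolour-hits onto i i≢cv

    separates : ¬ SamePartition c c′
    separates same = j≢cv (begin
      j       ≡⟨ sym (recolour-at {c = c} {v}) ⟩
      c′ v    ≡⟨ Equivalence.to (same v z) (trans (sym c′z≡cv) (recolour-elsewhere z≢v)) ⟩
      c′ z    ≡⟨ c′z≡cv ⟩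
      c v     ∎)
  split (no unused) = inj₁ (omit-colour c′ cv∉c′ ,
      refines-proper G (omit-colour-refines cv∉c′) pr′ ,
      omit-colour-onto cv∉c′ (recolour-hits onto) ,
      refines-distinguishing G (omit-colour-refines cv∉c′) dis′)
    where
    cv∉c′ : ∀ u → c v ≢ c′ u
    cv∉c′ u eq = unused (u , sym eq)

proposition4p2 : ∀ (n : ℕ) (G : Graph n) → Connected G → UniquelyDistColorable G →
    Σ (Fin n) (λ v → Pendant G v × FixedByAll G v) →
    IsDistNumber G 1 × IsDistChromatic G 2
proposition4p2 n G conn (k , χ@(_ , minimal) , c , c-dist@(pr , _ , dis) , unique) (v , (w , v~w , pend) , fix)
  with proper-colouring-needs-two G v~w c pr
... | s≤s (s≤s {n = zero} z≤n) =
  asymmetric⇒IsDistNumber-1 G v asymmetric , χ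
  where
  asymmetric : ∀ (φ : Aut G) u → σ φ u ≡ u
  asymmetric φ = dis φ (proper-2-colouring-invariant G conn fix c pr φ)
... | s≤s (s≤s {n = suc _} z≤n) with Fin-avoid₂ (c v) (c w)
...   | j , j≢cv , j≢cw with recolour-pendant G pend fix c-dist j≢cv j≢cw
...     | inj₁ fewer                     = ⊥-elim (minimal _ (n<1+n _) fewer)
...     | inj₂ (c′ , c′-dist , separates) = ⊥-elim (separates (unique c′ c′-dist))
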